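{- No natural number appears three or more times in the sequence $(a(n))_{n\ge 0}$; that is, there are no $x<y<z$ with $a(x)=a(y)=a(z)$.
   Context: Fibonacci numbers: $F_0=0$, $F_1=1$, $F_n=F_{n-1}+F_{n-2}$. The sequence $(a(n))_{n\geq 0}$ (OEIS A105774) is defined by $a(n)=n$ for $n\le 1$, and $a(n)=F_{j+1}-a(n-F_j)$ if $F_j<n\le F_{j+1}$ with $j\ge 2$. -}

module Defs where

open import Data.Nat using (ℕ; zero; suc; _+_; _∸_; _<_; _≤_; _<ᵇ_; _≤ᵇ_)
open import Data.Bool using (Bool; true; false; _∧_; if_then_else_)

F : ℕ → ℕ
F zero = 0
F (suc zero) = 1
F (suc (suc n)) = F (suc n) + F n

findJ : (b j0 n : ℕ) → ℕ
findJ zero j0 n = j0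
findJ (suc b) j0 n =
  if (F j0 <ᵇ n) ∧ (n ≤ᵇ F (suc j0)) then j0 else findJ b (suc j0) n

-- the index j ≥ 2 with F j < n ≤ F (j+1), for n ≥ 2
-- (for n ≥ 2 such a j exists and satisfies 2 ≤ j ≤ n + 1, so the bound n suffices)
jOf : ℕ → ℕ
jOf n = findJ n 2 n

-- fuel-based evaluation; the fuel n is sufficient since n - F j < n when j ≥ 2
aFuel : ℕ → ℕ → ℕ
aFuel zero n = n
aFuel (suc k) zero = 0
aFuel (suc k) (suc zero) = 1
aFuel (suc k) (suc (suc m)) =
  let n = suc (suc m) ; j = jOf n in F (suc j) ∸ aFuel k (n ∸ F j)

-- OEIS A105774: a(n) = n for n ≤ 1, a(n) = F(j+1) - a(n - F j) for F j < n ≤ F (j+1), j ≥ 2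
a : ℕ → ℕ
a n = aFuel n n

-- For j ≥ 2 the block (F j, F (j+1)] is mapped by a into [F j, F (j+1)): if n lies in it,
-- then 1 ≤ n − F j ≤ F (j−1), so by induction 1 ≤ a(n − F j) ≤ F (j−1), and
-- a(n) = F (j+1) − a(n − F j).  Hence equal values only occur inside one block, and there
-- a(n − F j) = F (j+1) − a(n), so shifting an equal-value triple x < y < z in block j down
-- by F j gives a smaller one.  This descent must end with x = 1, impossible since block j
-- contains y < z, forcing j ≥ 3 and a(z) ≥ F 3 = 2 > a(1).
module Submission where

open import Defs
open import Data.Nat
  using (ℕ; zero; suc; _+_; _∸_; _≤_; _<_; _≤′_; ≤′-refl; ≤′-step; _<ᵇ_; _≤ᵇ_; z≤n; s≤s)
open import Data.Nat.Properties
open import Data.Nat.Induction using (<-rec)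
open import Data.Bool using (true; false)
open import Data.Product using (_×_; _,_; proj₁; proj₂; ∃-syntax)
open import Data.Sum using (_⊎_; inj₁; inj₂)
open import Relation.Binary.PropositionalEquality
  using (_≡_; refl; sym; trans; cong; subst; module ≡-Reasoning)
open import Relation.Nullary using (¬_; yes; no; contradiction)
open import Relation.Nullary.Reflects using (ofʸ; ofⁿ)

F-≤-F-suc : ∀ n → F n ≤ F (suc n)
F-≤-F-suc zero = z≤n
F-≤-F-suc (suc zero) = ≤-refl
F-≤-F-suc (suc (suc n)) = m≤m+n _ _

F-mono-≤ : ∀ {m n} → m ≤ n → F m ≤ F n
F-mono-≤ m≤n = mono (≤⇒≤′ m≤n)
  where
  mono : ∀ {m n} → m ≤′ n → F m ≤ F n
  mono ≤′-refl = ≤-refl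
  mono (≤′-step {n} m≤′n) = ≤-trans (mono m≤′n) (F-≤-F-suc n)

F-pos : ∀ {n} → 1 ≤ n → 1 ≤ F n
F-pos = F-mono-≤

F-cancel-< : ∀ {m n} → F m < F n → m < n
F-cancel-< Fm<Fn = ≰⇒> (λ n≤m → <⇒≱ Fm<Fn (F-mono-≤ n≤m))

InBlock : ℕ → ℕ → Set
InBlock j n = F j < n × n ≤ F (suc j)

InRange : ℕ → ℕ → Set
InRange j v = F j ≤ v × v < F (suc j)

block-unique : ∀ {i k n} → InBlock i n → InBlock k n → i ≡ k
block-unique (Fi<n , n≤Fi+1) (Fk<n , n≤Fk+1) = ≤-antisym
  (≤-pred (F-cancel-< (<-≤-trans Fi<n n≤Fk+1)))
  (≤-pred (F-cancel-< (<-≤-trans Fk<n n≤Fi+1)))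

range-unique : ∀ {i k v} → InRange i v → InRange k v → i ≡ k
range-unique (Fi≤v , v<Fi+1) (Fk≤v , v<Fk+1) = ≤-antisym
  (≤-pred (F-cancel-< (≤-<-trans Fi≤v v<Fk+1)))
  (≤-pred (F-cancel-< (≤-<-trans Fk≤v v<Fi+1)))

block-≥2 : ∀ {j n} → 2 ≤ j → InBlock j n → 2 ≤ n
block-≥2 2≤j (Fj<n , _) = ≤-<-trans (F-pos (<⇒≤ 2≤j)) Fj<n

block-suc : ∀ {j n} → 1 ≤ j → InBlock j n → InBlock j (suc n) ⊎ InBlock (suc j) (suc n)
block-suc {j} 1≤j (Fj<n , n≤Fj+1) with m≤n⇒m<n∨m≡n n≤Fj+1
... | inj₁ n<Fj+1 = inj₁ (m<n⇒m<1+n Fj<n , n<Fj+1)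
... | inj₂ refl = inj₂ (≤-refl , ≤-trans (≤-reflexive (+-comm 1 (F (suc j))))
                                          (+-monoʳ-≤ (F (suc j)) (F-pos 1≤j)))

block-exists : ∀ n → 2 ≤ n → ∃[ j ] 2 ≤ j × j ≤ n × InBlock j n
block-exists (suc zero) (s≤s ())
block-exists (suc (suc zero)) _ = 2 , ≤-refl , ≤-refl , ≤-refl , ≤-refl
block-exists (suc (suc (suc m))) _ with block-exists (suc (suc m)) (s≤s (s≤s z≤n))
... | j , 2≤j , j≤n , B with block-suc (<⇒≤ 2≤j) B
...   | inj₁ B′ = j , 2≤j , m≤n⇒m≤1+n j≤n , B′
...   | inj₂ B′ = suc j , m≤n⇒m≤1+n 2≤j , s≤s j≤n , B′

findJ-hit : ∀ b {j n} → InBlock j n → findJ (suc b) j n ≡ j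
findJ-hit b {j} {n} (Fj<n , n≤Fj+1)
  with F j <ᵇ n | <ᵇ-reflects-< (F j) n | n ≤ᵇ F (suc j) | ≤ᵇ-reflects-≤ n (F (suc j))
... | true  | _          | true  | _          = refl
... | true  | _          | false | ofⁿ n≰Fj+1 = contradiction n≤Fj+1 n≰Fj+1
... | false | ofⁿ Fj≮n   | _     | _          = contradiction Fj<n Fj≮n

findJ-skip : ∀ b {j n} → ¬ InBlock j n → findJ (suc b) j n ≡ findJ b (suc j) n
findJ-skip b {j} {n} ¬B
  with F j <ᵇ n | <ᵇ-reflects-< (F j) n | n ≤ᵇ F (suc j) | ≤ᵇ-reflects-≤ n (F (suc j))
... | true  | ofʸ Fj<n | true  | ofʸ n≤Fj+1 = contradiction (Fj<n , n≤Fj+1) ¬B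
... | true  | _        | false | _          = refl
... | false | _        | _     | _          = refl

findJ-finds : ∀ b {j₀ j n} → j₀ ≤ j → j < b + j₀ → InBlock j n → findJ b j₀ n ≡ j
findJ-finds zero j₀≤j j<j₀ _ = contradiction j₀≤j (<⇒≱ j<j₀)
findJ-finds (suc b) {j₀} {j} j₀≤j j<b+j₀ B with j₀ ≟ j
... | yes refl = findJ-hit b B
... | no j₀≢j = trans (findJ-skip b (λ B₀ → j₀≢j (block-unique B₀ B)))
  (findJ-finds b (≤∧≢⇒< j₀≤j j₀≢j) (subst (j <_) (sym (+-suc b j₀)) j<b+j₀) B)

jOf-correct : ∀ {j n} → 2 ≤ j → InBlock j n → jOf n ≡ j
jOf-correct {n = n} 2≤j B with block-exists n (block-≥2 2≤j B)
... | j′ , 2≤j′ , j′≤n , B′ =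
  trans (findJ-finds n 2≤j′ (≤-<-trans j′≤n (m<m+n n (s≤s z≤n))) B′) (block-unique B′ B)

jOf-≥2 : ∀ {n} → 2 ≤ n → 2 ≤ jOf n
jOf-≥2 {n} 2≤n with block-exists n 2≤n
... | j , 2≤j , _ , B = subst (2 ≤_) (sym (jOf-correct 2≤j B)) 2≤j

aFuel-irrelevant : ∀ {k k′ n} → n ≤ k → n ≤ k′ → aFuel k n ≡ aFuel k′ n
aFuel-irrelevant {zero}  {zero}   {zero} _ _ = refl
aFuel-irrelevant {zero}  {suc _}  {zero} _ _ = refl
aFuel-irrelevant {suc _} {zero}   {zero} _ _ = refl
aFuel-irrelevant {suc _} {suc _}  {zero} _ _ = refl
aFuel-irrelevant {suc _} {suc _}  {suc zero} _ _ = refl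
aFuel-irrelevant {suc k} {suc k′} {suc (suc m)} (s≤s n≤k) (s≤s n≤k′) =
  cong (F (suc j) ∸_) (aFuel-irrelevant (≤-trans r≤m+1 n≤k) (≤-trans r≤m+1 n≤k′))
  where
  j = jOf (suc (suc m))
  r≤m+1 : suc (suc m) ∸ F j ≤ suc m
  r≤m+1 = ∸-monoʳ-≤ (suc (suc m)) (F-pos (<⇒≤ (jOf-≥2 {suc (suc m)} (s≤s (s≤s z≤n)))))

a-step : ∀ {j n} → 2 ≤ j → InBlock j n → a n ≡ F (suc j) ∸ a (n ∸ F j)
a-step {n = zero} _ (() , _)
a-step {n = suc zero} 2≤j B = contradiction (block-≥2 2≤j B) λ { (s≤s ()) }
a-step {j} {n@(suc (suc m))} 2≤j B = begin
  F (suc (jOf n)) ∸ aFuel (suc m) (n ∸ F (jOf n))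
    ≡⟨ cong (λ i → F (suc i) ∸ aFuel (suc m) (n ∸ F i)) (jOf-correct 2≤j B) ⟩
  F (suc j) ∸ aFuel (suc m) (n ∸ F j)
    ≡⟨ cong (F (suc j) ∸_) (aFuel-irrelevant r≤m+1 ≤-refl) ⟩
  F (suc j) ∸ a (n ∸ F j) ∎
  where
  open ≡-Reasoning
  r≤m+1 : n ∸ F j ≤ suc m
  r≤m+1 = ∸-monoʳ-≤ n (F-pos (<⇒≤ 2≤j))

MapsBlockToRange : ℕ → Set
MapsBlockToRange n = ∀ {j} → 2 ≤ j → InBlock j n → InRange j (a n)

a-pos-≤-F : ∀ {m i} → MapsBlockToRange m → 1 ≤ m → m ≤ F i → 1 ≤ a m × a m ≤ F i
a-pos-≤-F {suc zero} _ _ 1≤Fi = ≤-refl , 1≤Fi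
a-pos-≤-F {m@(suc (suc _))} {i} range _ m≤Fi with block-exists m (s≤s (s≤s z≤n))
... | k , 2≤k , _ , B@(Fk<m , _) with range 2≤k B
...   | Fk≤am , am<Fk+1 =
  ≤-trans (F-pos (<⇒≤ 2≤k)) Fk≤am ,
  <⇒≤ (<-≤-trans am<Fk+1 (F-mono-≤ (F-cancel-< {k} {i} (<-≤-trans Fk<m m≤Fi))))

m≤[m+n]∸o<m+n : ∀ m {n o} → 1 ≤ o → o ≤ n → m ≤ (m + n) ∸ o × (m + n) ∸ o < m + n
m≤[m+n]∸o<m+n m {n} {o} 1≤o o≤n =
  subst (m ≤_) (sym (+-∸-assoc m o≤n)) (m≤m+n m (n ∸ o)) ,
  ∸-monoʳ-< {o = 0} 1≤o (≤-trans o≤n (m≤n+m n m))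

a-maps-block-to-range : ∀ n → (∀ {m} → m < n → MapsBlockToRange m) → MapsBlockToRange n
a-maps-block-to-range n rec {suc i} (s≤s 1≤i) B@(Fi+1<n , n≤Fi+2) =
  subst (InRange (suc i)) (sym (a-step {suc i} {n} (s≤s 1≤i) B))
    (m≤[m+n]∸o<m+n (F (suc i)) (proj₁ bounds) (proj₂ bounds))
  where
  r = n ∸ F (suc i)
  r<n : r < n
  r<n = ∸-monoʳ-< {o = 0} (F-pos {suc i} (s≤s z≤n)) (<⇒≤ Fi+1<n)
  r≤Fi : r ≤ F i
  r≤Fi = subst (r ≤_) (m+n∸m≡n (F (suc i)) (F i)) (∸-monoˡ-≤ (F (suc i)) n≤Fi+2)
  bounds : 1 ≤ a r × a r ≤ F i
  bounds = a-pos-≤-F {r} {i} (rec r<n) (m<n⇒0<n∸m Fi+1<n) r≤Fi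

a-range : ∀ {j n} → 2 ≤ j → InBlock j n → InRange j (a n)
a-range {n = n} = <-rec MapsBlockToRange a-maps-block-to-range n

a-pos : ∀ {n} → 1 ≤ n → 1 ≤ a n
a-pos {suc zero} _ = ≤-refl
a-pos {n@(suc (suc _))} _ with block-exists n (s≤s (s≤s z≤n))
... | j , 2≤j , _ , B = ≤-trans (F-pos (<⇒≤ 2≤j)) (proj₁ (a-range 2≤j B))

a-residue : ∀ {j n} → 2 ≤ j → InBlock j n → a (n ∸ F j) ≡ F (suc j) ∸ a n
a-residue {j} {n} 2≤j B@(Fj<n , n≤Fj+1) = begin
  a r                           ≡⟨ sym (m∸[m∸n]≡n ar≤Fj+1) ⟩
  F (suc j) ∸ (F (suc j) ∸ a r) ≡⟨ cong (F (suc j) ∸_) (sym (a-step 2≤j B)) ⟩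
  F (suc j) ∸ a n               ∎
  where
  open ≡-Reasoning
  r = n ∸ F j
  ar≤Fj+1 : a r ≤ F (suc j)
  ar≤Fj+1 = proj₂ (a-pos-≤-F {r} {suc j} (λ {k} → a-range {k} {r})
    (m<n⇒0<n∸m Fj<n) (≤-trans (m∸n≤m n (F j)) n≤Fj+1))

block-of-equal-value : ∀ {j u v} → 2 ≤ j → InBlock j v → 2 ≤ u → a u ≡ a v → InBlock j u
block-of-equal-value {j} {u} 2≤j Bv 2≤u au≡av with block-exists u 2≤u
... | i , 2≤i , _ , Bu = subst (λ k → InBlock k u)
  (range-unique {i} {j} (a-range 2≤i Bu) (subst (InRange j) (sym au≡av) (a-range 2≤j Bv))) Bu

EqualTriple : ℕ → ℕ → ℕ → Set
EqualTriple x y z = 1 ≤ x × x < y × y < z × a x ≡ a y × a y ≡ a z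

triple-block : ∀ {x y z} → EqualTriple x y z → ∃[ j ] 3 ≤ j × InBlock j y × InBlock j z
triple-block {y = y} {z} (1≤x , x<y , y<z , _ , ay≡az)
  with block-exists z (≤-trans (≤-trans (s≤s 1≤x) x<y) (<⇒≤ y<z))
... | j , 2≤j , _ , Bz = j , 3≤j , block-of-equal-value 2≤j Bz 2≤y ay≡az , Bz
  where
  2≤y : 2 ≤ y
  2≤y = ≤-trans (s≤s 1≤x) x<y
  3≤j : 3 ≤ j
  3≤j = ≤-pred (F-cancel-< {3} {suc j} (<-≤-trans (≤-<-trans 2≤y y<z) (proj₂ Bz)))

triple-not-at-1 : ∀ {y z} → ¬ EqualTriple 1 y z
triple-not-at-1 T@(_ , _ , _ , a1≡ay , ay≡az) with triple-block T
... | j , 3≤j , _ , Bz =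
  <⇒≢ (≤-trans (F-mono-≤ {3} {j} 3≤j) (proj₁ (a-range (<⇒≤ 3≤j) Bz))) (trans a1≡ay ay≡az)

triple-descend : ∀ {x y z} → 2 ≤ x → EqualTriple x y z →
  ∃[ j ] z ∸ F j < z × EqualTriple (x ∸ F j) (y ∸ F j) (z ∸ F j)
triple-descend {x} 2≤x T@(_ , x<y , y<z , ax≡ay , ay≡az) with triple-block T
... | j , 3≤j , By@(Fj<y , _) , Bz@(Fj<z , _) =
  j , ∸-monoʳ-< {o = 0} (F-pos {j} (<⇒≤ 2≤j)) (<⇒≤ Fj<z) ,
  m<n⇒0<n∸m Fj<x , ∸-monoˡ-< x<y (<⇒≤ Fj<x) , ∸-monoˡ-< y<z (<⇒≤ Fj<y) ,
  shift ax≡ay Bx By , shift ay≡az By Bz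
  where
  2≤j : 2 ≤ j
  2≤j = <⇒≤ 3≤j
  Bx : InBlock j x
  Bx = block-of-equal-value 2≤j By 2≤x ax≡ay
  Fj<x = proj₁ Bx
  shift : ∀ {u v} → a u ≡ a v → InBlock j u → InBlock j v → a (u ∸ F j) ≡ a (v ∸ F j)
  shift {u} {v} au≡av Bu Bv = begin
    a (u ∸ F j)     ≡⟨ a-residue 2≤j Bu ⟩
    F (suc j) ∸ a u ≡⟨ cong (F (suc j) ∸_) au≡av ⟩
    F (suc j) ∸ a v ≡⟨ sym (a-residue 2≤j Bv) ⟩
    a (v ∸ F j)     ∎
    where open ≡-Reasoning

NoEqualTripleBelow : ℕ → Set
NoEqualTripleBelow z = ∀ {x y} → ¬ EqualTriple x y z

no-equal-triple : ∀ z → NoEqualTripleBelow z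
no-equal-triple = <-rec NoEqualTripleBelow step
  where
  step : ∀ z → (∀ {z′} → z′ < z → NoEqualTripleBelow z′) → NoEqualTripleBelow z
  step z rec {zero} (() , _)
  step z rec {suc zero} T = triple-not-at-1 T
  step z rec {suc (suc _)} T with triple-descend (s≤s (s≤s z≤n)) T
  ... | _ , z′<z , T′ = rec z′<z T′

proposition1 : (x y z : ℕ) → x < y → y < z → ¬ (a x ≡ a y × a y ≡ a z)
proposition1 zero y z 0<y _ (a0≡ay , _) = <⇒≢ (a-pos 0<y) a0≡ay
proposition1 (suc x) y z x<y y<z (ax≡ay , ay≡az) =
  no-equal-triple z (s≤s z≤n , x<y , y<z , ax≡ay , ay≡az)
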